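{- Let $\mathbb{V}$ be a cartesian category with distributive countable coproducts and $p:\mathbb{P}\to\mathbb{V}$ a fibration for assertion logic. Let $\{\mathrm{true},\mathrm{false}\in\mathbb{V}(1,B)\}$ be a coproduct in $\mathbb{V}$, $X\in\mathbb{V}$, $\psi\in\mathbb{P}_X$, $e\in\mathbb{V}(X,B)$, $f_{\mathrm{true}}=\langle\mathrm{id}_X,\mathrm{true}\circ!_X\rangle$, $f_{\mathrm{false}}=\langle\mathrm{id}_X,\mathrm{false}\circ!_X\rangle$ and $\mathrm{Im}=\langle\mathrm{id}_X,e\rangle_*\psi$. If $\psi\le\mathrm{Eq}(e,\mathrm{true}\circ!_X)\vee\mathrm{Eq}(e,\mathrm{false}\circ!_X)$ in $\mathbb{P}_X$, then $$\mathrm{Im}=(f_{\mathrm{true}})_*f_{\mathrm{true}}^*\mathrm{Im}\ \vee\ (f_{\mathrm{false}})_*f_{\mathrm{false}}^*\mathrm{Im}.$$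
   Context: A posetal fibration $p:\mathbb{P}\to\mathbb{V}$ has poset fibres $\mathbb{P}_X$ and monotone reindexing maps $f^*:\mathbb{P}_Y\to\mathbb{P}_X$ for $f\in\mathbb{V}(X,Y)$. A fibration for assertion logic over $\mathbb{V}$ (cartesian with distributive countable coproducts) is a posetal fibration with: (1) each fibre a distributive lattice with finite meets $\top,\wedge$ and countable joins $\bot,\vee$; (2) each $f^*$ preserving finite meets and countable joins; (3) left adjoints $\mathrm{Eq}_{X,Y}\dashv c_{X,Y}^*$ for $c_{X,Y}=\langle\pi_1,\pi_2,\pi_2\rangle:X\times Y\to X\times Y\times Y$, satisfying Beck–Chevalley ($\mathrm{Eq}_{Z,Y}\circ(f\times Y)^*=(f\times Y\times Y)^*\circ\mathrm{Eq}_{X,Y}$) and Frobenius ($\mathrm{Eq}_{X,Y}(c^*\psi\wedge\phi)=\psi\wedge\mathrm{Eq}_{X,Y}\phi$); (4) left adjoints $\exists_{X,Y}\dashv\pi_1^*$ for $\pi_1:X\times Y\to X$, satisfying Beck–Chevalley ($\exists_{X,Y}\circ(f\times Y)^*=f^*\circ\exists_{Z,Y}$) and Frobenius ($\exists_{X,Y}(\pi_1^*\psi\wedge\phi)=\psi\wedge\exists_{X,Y}\phi$). $\mathrm{Eq}(f,g)=\langle\mathrm{id}_X,f,g\rangle^*\mathrm{Eq}_{X,Y}(\top)$ for $f,g\in\mathbb{V}(X,Y)$. $f_*$ denotes the left adjoint of $f^*$, given by $f_*\psi=\exists_{Y,X}(\pi_2^*\psi\wedge\mathrm{Eq}(f\circ\pi_2,\pi_1))$.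 -}

module Defs where

open import Level using (Level; _⊔_) renaming (suc to lsuc)
open import Data.Nat using (ℕ)
open import Data.Bool using (Bool; true; false)
open import Data.Product using (_×_; _,_)
open import Function.Bundles using (_↣_)
open import Relation.Binary.Core using (Rel)
open import Relation.Binary.Structures using (IsEquivalence; IsPartialOrder)
open import Relation.Binary.PropositionalEquality using (_≡_)

Countable : Set → Set
Countable I = I ↣ ℕ

record Category (o ℓ e : Level) : Set (lsuc (o ⊔ ℓ ⊔ e)) where
  infixr 9 _∘_
  infix  4 _≈_
  infix  3 _⇒_
  field
    Obj : Set o
    _⇒_ : Obj → Obj → Set ℓ
    _≈_ : ∀ {A B} → Rel (A ⇒ B) e
    id  : ∀ {A} → A ⇒ A
    _∘_ : ∀ {A B C} → B ⇒ C → A ⇒ B → A ⇒ C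
    ≈-isEquivalence : ∀ {A B} → IsEquivalence (_≈_ {A} {B})
    ∘-resp-≈  : ∀ {A B C} {f h : B ⇒ C} {g i : A ⇒ B} → f ≈ h → g ≈ i → f ∘ g ≈ h ∘ i
    identityˡ : ∀ {A B} {f : A ⇒ B} → id ∘ f ≈ f
    identityʳ : ∀ {A B} {f : A ⇒ B} → f ∘ id ≈ f
    assoc     : ∀ {A B C D} {f : A ⇒ B} {g : B ⇒ C} {h : C ⇒ D} →
                (h ∘ g) ∘ f ≈ h ∘ (g ∘ f)

module _ {o ℓ e} (𝒞 : Category o ℓ e) where
  open Category 𝒞

  record IsCoproduct {I : Set} (A : I → Obj) (S : Obj) (ι : ∀ i → A i ⇒ S)
         : Set (o ⊔ ℓ ⊔ e) where
    field
      [_]      : ∀ {C} → (∀ i → A i ⇒ C) → S ⇒ C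
      inject   : ∀ {C} (g : ∀ i → A i ⇒ C) i → [ g ] ∘ ι i ≈ g i
      unique   : ∀ {C} (g : ∀ i → A i ⇒ C) (h : S ⇒ C) →
                 (∀ i → h ∘ ι i ≈ g i) → h ≈ [ g ]

  record Cartesian : Set (o ⊔ ℓ ⊔ e) where
    infixr 7 _×ₒ_
    field
      𝟙     : Obj
      !     : ∀ {A} → A ⇒ 𝟙
      !-unique : ∀ {A} (f : A ⇒ 𝟙) → f ≈ !
      _×ₒ_  : Obj → Obj → Obj
      π₁    : ∀ {A B} → A ×ₒ B ⇒ A
      π₂    : ∀ {A B} → A ×ₒ B ⇒ B
      ⟨_,_⟩ : ∀ {C A B} → C ⇒ A → C ⇒ B → C ⇒ A ×ₒ B
      project₁ : ∀ {C A B} {f : C ⇒ A} {g : C ⇒ B} → π₁ ∘ ⟨ f , g ⟩ ≈ f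
      project₂ : ∀ {C A B} {f : C ⇒ A} {g : C ⇒ B} → π₂ ∘ ⟨ f , g ⟩ ≈ g
      ⟨⟩-unique : ∀ {C A B} {f : C ⇒ A} {g : C ⇒ B} (h : C ⇒ A ×ₒ B) →
                  π₁ ∘ h ≈ f → π₂ ∘ h ≈ g → h ≈ ⟨ f , g ⟩

    _⊗id : ∀ {A B Y} → A ⇒ B → A ×ₒ Y ⇒ B ×ₒ Y
    f ⊗id = ⟨ f ∘ π₁ , π₂ ⟩

  record DistributiveCountableCoproducts (C : Cartesian) : Set (lsuc (o ⊔ ℓ ⊔ e)) where
    open Cartesian C
    field
      ∐ : ∀ {I : Set} → Countable I → (I → Obj) → Obj
      ι : ∀ {I : Set} (c : Countable I) (A : I → Obj) i → A i ⇒ ∐ c A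
      ∐-isCoproduct : ∀ {I : Set} (c : Countable I) (A : I → Obj) →
                      IsCoproduct A (∐ c A) (ι c A)
      distributive : ∀ {I : Set} → Countable I → (A : I → Obj) (S : Obj)
                     (ι′ : ∀ i → A i ⇒ S) → IsCoproduct A S ι′ →
                     ∀ X → IsCoproduct (λ i → X ×ₒ A i) (X ×ₒ S)
                                       (λ i → ⟨ π₁ , ι′ i ∘ π₂ ⟩)

-- Posetal fibrations, presented by their poset fibres ℙ_X and monotone
-- reindexing maps f^* (strictly functorial, as fibres are posets).

record PosetalFibration {o ℓ e} (𝕍 : Category o ℓ e) (p q : Level)
       : Set (o ⊔ ℓ ⊔ e ⊔ lsuc (p ⊔ q)) where
  open Category 𝕍
  infix 4 _⊑_
  field
    Fib : Obj → Set p
    _⊑_ : ∀ {X} → Rel (Fib X) q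
    ⊑-isPartialOrder : ∀ {X} → IsPartialOrder _≡_ (_⊑_ {X})
    _^* : ∀ {X Y} → X ⇒ Y → Fib Y → Fib X
    ^*-mono  : ∀ {X Y} (f : X ⇒ Y) {φ ψ} → φ ⊑ ψ → (f ^*) φ ⊑ (f ^*) ψ
    ^*-resp-≈ : ∀ {X Y} {f g : X ⇒ Y} → f ≈ g → ∀ φ → (f ^*) φ ≡ (g ^*) φ
    ^*-id    : ∀ {X} (φ : Fib X) → (id ^*) φ ≡ φ
    ^*-∘     : ∀ {X Y Z} (g : Y ⇒ Z) (f : X ⇒ Y) φ → ((g ∘ f) ^*) φ ≡ (f ^*) ((g ^*) φ)

record AssertionFibration {o ℓ e} (𝕍 : Category o ℓ e) (C : Cartesian 𝕍) (p q : Level)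
       : Set (o ⊔ ℓ ⊔ e ⊔ lsuc (p ⊔ q)) where
  open Category 𝕍
  open Cartesian C
  field
    posetal : PosetalFibration 𝕍 p q
  open PosetalFibration posetal public
  infixr 6 _∧_
  infixr 5 _∨_
  field
    ⊤ : ∀ {X} → Fib X
    _∧_ : ∀ {X} → Fib X → Fib X → Fib X
    ⊥ : ∀ {X} → Fib X
    _∨_ : ∀ {X} → Fib X → Fib X → Fib X
    ⋁ : ∀ {X} {I : Set} → Countable I → (I → Fib X) → Fib X
    ⊤-max : ∀ {X} (φ : Fib X) → φ ⊑ ⊤
    ∧-lb₁ : ∀ {X} (φ ψ : Fib X) → φ ∧ ψ ⊑ φ
    ∧-lb₂ : ∀ {X} (φ ψ : Fib X) → φ ∧ ψ ⊑ ψ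
    ∧-glb : ∀ {X} {χ φ ψ : Fib X} → χ ⊑ φ → χ ⊑ ψ → χ ⊑ φ ∧ ψ
    ⊥-min : ∀ {X} (φ : Fib X) → ⊥ ⊑ φ
    ∨-ub₁ : ∀ {X} (φ ψ : Fib X) → φ ⊑ φ ∨ ψ
    ∨-ub₂ : ∀ {X} (φ ψ : Fib X) → ψ ⊑ φ ∨ ψ
    ∨-lub : ∀ {X} {χ φ ψ : Fib X} → φ ⊑ χ → ψ ⊑ χ → φ ∨ ψ ⊑ χ
    ⋁-ub  : ∀ {X} {I : Set} (c : Countable I) (φ : I → Fib X) i → φ i ⊑ ⋁ c φ
    ⋁-lub : ∀ {X} {I : Set} (c : Countable I) (φ : I → Fib X) {χ} →
            (∀ i → φ i ⊑ χ) → ⋁ c φ ⊑ χ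
    distrib : ∀ {X} (φ ψ χ : Fib X) → φ ∧ (ψ ∨ χ) ⊑ (φ ∧ ψ) ∨ (φ ∧ χ)
    ^*-⊤ : ∀ {X Y} (f : X ⇒ Y) → (f ^*) ⊤ ≡ ⊤
    ^*-∧ : ∀ {X Y} (f : X ⇒ Y) φ ψ → (f ^*) (φ ∧ ψ) ≡ (f ^*) φ ∧ (f ^*) ψ
    ^*-⊥ : ∀ {X Y} (f : X ⇒ Y) → (f ^*) ⊥ ≡ ⊥
    ^*-∨ : ∀ {X Y} (f : X ⇒ Y) φ ψ → (f ^*) (φ ∨ ψ) ≡ (f ^*) φ ∨ (f ^*) ψ
    ^*-⋁ : ∀ {X Y} (f : X ⇒ Y) {I : Set} (c : Countable I) (φ : I → Fib Y) →
           (f ^*) (⋁ c φ) ≡ ⋁ c (λ i → (f ^*) (φ i))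

  cmap : ∀ {X Y} → X ×ₒ Y ⇒ (X ×ₒ Y) ×ₒ Y
  cmap = ⟨ ⟨ π₁ , π₂ ⟩ , π₂ ⟩

  field
    Eqₗ : ∀ {X Y} → Fib (X ×ₒ Y) → Fib ((X ×ₒ Y) ×ₒ Y)
    Eq-adj₁ : ∀ {X Y} {φ : Fib (X ×ₒ Y)} {ψ} → Eqₗ φ ⊑ ψ → φ ⊑ (cmap ^*) ψ
    Eq-adj₂ : ∀ {X Y} {φ : Fib (X ×ₒ Y)} {ψ} → φ ⊑ (cmap ^*) ψ → Eqₗ φ ⊑ ψ
    Eq-BC : ∀ {X Z Y} (f : Z ⇒ X) (φ : Fib (X ×ₒ Y)) →
            Eqₗ (((_⊗id {Y = Y} f) ^*) φ) ≡ ((_⊗id {Y = Y} (f ⊗id)) ^*) (Eqₗ φ)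
    Eq-Frob : ∀ {X Y} (ψ : Fib ((X ×ₒ Y) ×ₒ Y)) (φ : Fib (X ×ₒ Y)) →
              Eqₗ ((cmap ^*) ψ ∧ φ) ≡ ψ ∧ Eqₗ φ
    ∃ₗ : ∀ {X Y} → Fib (X ×ₒ Y) → Fib X
    ∃-adj₁ : ∀ {X Y} {φ : Fib (X ×ₒ Y)} {ψ} → ∃ₗ φ ⊑ ψ → φ ⊑ (π₁ ^*) ψ
    ∃-adj₂ : ∀ {X Y} {φ : Fib (X ×ₒ Y)} {ψ} → φ ⊑ (π₁ ^*) ψ → ∃ₗ φ ⊑ ψ
    ∃-BC : ∀ {X Z Y} (f : X ⇒ Z) (φ : Fib (Z ×ₒ Y)) →
           ∃ₗ (((_⊗id {Y = Y} f) ^*) φ) ≡ (f ^*) (∃ₗ φ)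
    ∃-Frob : ∀ {X Y} (ψ : Fib X) (φ : Fib (X ×ₒ Y)) →
             ∃ₗ ((π₁ ^*) ψ ∧ φ) ≡ ψ ∧ ∃ₗ φ

  EqP : ∀ {X Y} → X ⇒ Y → X ⇒ Y → Fib X
  EqP f g = (⟨ ⟨ id , f ⟩ , g ⟩ ^*) (Eqₗ ⊤)

  _₊ : ∀ {X Y} → X ⇒ Y → Fib X → Fib Y
  _₊ {X} {Y} f ψ = ∃ₗ {Y} {X} ((π₂ ^*) ψ ∧ EqP (f ∘ π₂) π₁)

-- Writing I = ⟨id,e⟩₊ ψ, the inequality ⊒ is two counits of f₊ ⊣ f^*. For ⊑,
-- transpose along ⟨id,e⟩ and split ψ ⊑ (ψ ∧ Eq(e,t)) ∨ (ψ ∧ Eq(e,f)) by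
-- distributivity. On the part where e = c (c = t∘! or f∘!), Leibniz transport
-- along Eq(e,c) moves I from the graph of e to the graph of c and, after the unit
-- of ⟨id,c⟩₊ ⊣ ⟨id,c⟩^*, back again.
module Submission where

open import Defs
open import Level using (Level)
open import Data.Bool using (Bool; if_then_else_)
open import Relation.Binary.PropositionalEquality using (_≡_)
import Relation.Binary.PropositionalEquality as ≡
open import Relation.Binary.Bundles using (Poset)
open import Relation.Binary.Structures using (IsEquivalence; IsPartialOrder)
import Relation.Binary.Reasoning.PartialOrder as PartialOrderReasoning

module AssertionLogic {o ℓ e p q} {𝕍 : Category o ℓ e} {C : Cartesian 𝕍}
                      (ℙ : AssertionFibration 𝕍 C p q) where
  open Category 𝕍
  open Cartesian C
  open AssertionFibration ℙ

  private
    module ≈ {A B} = IsEquivalence (≈-isEquivalence {A} {B})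
    module ⊑ {X} = IsPartialOrder (⊑-isPartialOrder {X})

  infixr 4 _≫_
  _≫_ : ∀ {A B} {f g h : A ⇒ B} → f ≈ g → g ≈ h → f ≈ h
  _≫_ = ≈.trans

  fibrePoset : Obj → Poset p p q
  fibrePoset X = record { isPartialOrder = ⊑-isPartialOrder {X} }

  module ⊑-Reasoning {X : Obj} = PartialOrderReasoning (fibrePoset X)
  open ⊑-Reasoning

  ⟨⟩∘ : ∀ {W D A B} {f : D ⇒ A} {g : D ⇒ B} {h : W ⇒ D} →
        ⟨ f , g ⟩ ∘ h ≈ ⟨ f ∘ h , g ∘ h ⟩
  ⟨⟩∘ = ⟨⟩-unique _ (≈.sym assoc ≫ ∘-resp-≈ project₁ ≈.refl)
                    (≈.sym assoc ≫ ∘-resp-≈ project₂ ≈.refl)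

  ⟨⟩-cong₂ : ∀ {D A B} {f f′ : D ⇒ A} {g g′ : D ⇒ B} →
             f ≈ f′ → g ≈ g′ → ⟨ f , g ⟩ ≈ ⟨ f′ , g′ ⟩
  ⟨⟩-cong₂ f≈f′ g≈g′ = ⟨⟩-unique _ (project₁ ≫ f≈f′) (project₂ ≫ g≈g′)

  ⟨π₁,π₂⟩≈id : ∀ {A B} → ⟨ π₁ , π₂ ⟩ ≈ id {A ×ₒ B}
  ⟨π₁,π₂⟩≈id = ≈.sym (⟨⟩-unique id identityʳ identityʳ)

  π₁∘π₁-⟨⟨⟩,⟩ : ∀ {W A B C} {f : W ⇒ A} {g : W ⇒ B} {h : W ⇒ C} →
                 (π₁ ∘ π₁) ∘ ⟨ ⟨ f , g ⟩ , h ⟩ ≈ f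
  π₁∘π₁-⟨⟨⟩,⟩ = assoc ≫ ∘-resp-≈ ≈.refl project₁ ≫ project₁

  ^*-compose : ∀ {X Y Z} {g : Y ⇒ Z} {f : X ⇒ Y} {h : X ⇒ Z} →
               g ∘ f ≈ h → ∀ φ → (f ^*) ((g ^*) φ) ≡ (h ^*) φ
  ^*-compose {g = g} {f} g∘f≈h φ = ≡.trans (≡.sym (^*-∘ g f φ)) (^*-resp-≈ g∘f≈h φ)

  ∧-monoˡ : ∀ {X} {φ φ′ : Fib X} (ψ : Fib X) → φ ⊑ φ′ → φ ∧ ψ ⊑ φ′ ∧ ψ
  ∧-monoˡ ψ φ⊑φ′ = ∧-glb (⊑.trans (∧-lb₁ _ ψ) φ⊑φ′) (∧-lb₂ _ ψ)

  ∨-mono : ∀ {X} {φ φ′ ψ ψ′ : Fib X} → φ ⊑ φ′ → ψ ⊑ ψ′ → φ ∨ ψ ⊑ φ′ ∨ ψ′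
  ∨-mono φ⊑φ′ ψ⊑ψ′ = ∨-lub (⊑.trans φ⊑φ′ (∨-ub₁ _ _)) (⊑.trans ψ⊑ψ′ (∨-ub₂ _ _))

  -- Frobenius rewrites the left side as Eqₗ (cmap^* (π₁^* χ)), and both
  -- π₁ and ⟨π₁∘π₁,π₂⟩ restrict to the identity along cmap.
  Eqₗ-Leibniz : ∀ {Z Y} (χ : Fib (Z ×ₒ Y)) →
                (π₁ ^*) χ ∧ Eqₗ {Z} {Y} ⊤ ⊑ (⟨ π₁ ∘ π₁ , π₂ ⟩ ^*) χ
  Eqₗ-Leibniz χ = ≡.subst (_⊑ (⟨ π₁ ∘ π₁ , π₂ ⟩ ^*) χ) (Eq-Frob ((π₁ ^*) χ) ⊤) (Eq-adj₂ restricted)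
    where
    restricted : (cmap ^*) ((π₁ ^*) χ) ∧ ⊤ ⊑ (cmap ^*) ((⟨ π₁ ∘ π₁ , π₂ ⟩ ^*) χ)
    restricted = begin
      (cmap ^*) ((π₁ ^*) χ) ∧ ⊤                 ≤⟨ ∧-lb₁ _ _ ⟩
      (cmap ^*) ((π₁ ^*) χ)                     ≡⟨ ^*-compose (project₁ ≫ ⟨π₁,π₂⟩≈id) χ ⟩
      (id ^*) χ                                 ≡⟨ ≡.sym (^*-compose m∘cmap≈id χ) ⟩
      (cmap ^*) ((⟨ π₁ ∘ π₁ , π₂ ⟩ ^*) χ)       ∎
      where
      m∘cmap≈id : ⟨ π₁ ∘ π₁ , π₂ ⟩ ∘ cmap ≈ id
      m∘cmap≈id = ⟨⟩∘ ≫ ⟨⟩-cong₂ π₁∘π₁-⟨⟨⟩,⟩ project₂ ≫ ⟨π₁,π₂⟩≈id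

  EqP-transport : ∀ {X Y} (a b : X ⇒ Y) (χ : Fib (X ×ₒ Y)) →
                  (⟨ id , a ⟩ ^*) χ ∧ EqP a b ⊑ (⟨ id , b ⟩ ^*) χ
  EqP-transport {X} {Y} a b χ = begin
    (⟨ id , a ⟩ ^*) χ ∧ EqP a b               ≡⟨ ≡.cong (_∧ EqP a b) (≡.sym (^*-compose project₁ χ)) ⟩
    (g ^*) ((π₁ ^*) χ) ∧ (g ^*) (Eqₗ ⊤)       ≡⟨ ≡.sym (^*-∧ g _ _) ⟩
    (g ^*) ((π₁ ^*) χ ∧ Eqₗ ⊤)                ≤⟨ ^*-mono g (Eqₗ-Leibniz χ) ⟩
    (g ^*) ((⟨ π₁ ∘ π₁ , π₂ ⟩ ^*) χ)          ≡⟨ ^*-compose (⟨⟩∘ ≫ ⟨⟩-cong₂ π₁∘π₁-⟨⟨⟩,⟩ project₂) χ ⟩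
    (⟨ id , b ⟩ ^*) χ                         ∎
    where
    g : X ⇒ (X ×ₒ Y) ×ₒ Y
    g = ⟨ ⟨ id , a ⟩ , b ⟩

  Eqₗ-refl : ∀ {W Z Y} (u : W ⇒ Z) (v : W ⇒ Y) → ⊤ ⊑ (⟨ ⟨ u , v ⟩ , v ⟩ ^*) (Eqₗ ⊤)
  Eqₗ-refl u v = begin
    ⊤                                         ≡⟨ ≡.sym (^*-⊤ ⟨ u , v ⟩) ⟩
    (⟨ u , v ⟩ ^*) ⊤                          ≤⟨ ^*-mono ⟨ u , v ⟩ (Eq-adj₁ ⊑.refl) ⟩
    (⟨ u , v ⟩ ^*) ((cmap ^*) (Eqₗ ⊤))        ≡⟨ ^*-compose cmap∘⟨u,v⟩ _ ⟩
    (⟨ ⟨ u , v ⟩ , v ⟩ ^*) (Eqₗ ⊤)            ∎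
    where
    cmap∘⟨u,v⟩ : cmap ∘ ⟨ u , v ⟩ ≈ ⟨ ⟨ u , v ⟩ , v ⟩
    cmap∘⟨u,v⟩ = ⟨⟩∘ ≫ ⟨⟩-cong₂ (⟨⟩∘ ≫ ⟨⟩-cong₂ project₁ project₂) project₂

  EqP-sym : ∀ {X Y} (a b : X ⇒ Y) → EqP a b ⊑ EqP b a
  EqP-sym {X} {Y} a b = begin
    EqP a b                                   ≤⟨ ∧-glb (⊑.trans (⊤-max _) (Eqₗ-refl id a)) ⊑.refl ⟩
    EqP a a ∧ EqP a b                         ≡⟨ ≡.cong (_∧ EqP a b) (≡.sym (restrict a)) ⟩
    (⟨ id , a ⟩ ^*) χ ∧ EqP a b               ≤⟨ EqP-transport a b χ ⟩
    (⟨ id , b ⟩ ^*) χ                         ≡⟨ restrict b ⟩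
    EqP b a                                   ∎
    where
    χ : Fib (X ×ₒ Y)
    χ = (⟨ id , a ∘ π₁ ⟩ ^*) (Eqₗ ⊤)
    restrict : ∀ c → (⟨ id , c ⟩ ^*) χ ≡ EqP c a
    restrict c = ^*-compose (⟨⟩∘ ≫ ⟨⟩-cong₂ identityˡ (assoc ≫ ∘-resp-≈ ≈.refl project₁ ≫ identityʳ))
                            (Eqₗ ⊤)

  ∃-intro : ∀ {W X Y} (g : W ⇒ X) (s : W ⇒ Y) (χ : Fib (X ×ₒ Y)) →
            (⟨ g , s ⟩ ^*) χ ⊑ (g ^*) (∃ₗ χ)
  ∃-intro g s χ = begin
    (⟨ g , s ⟩ ^*) χ                          ≤⟨ ^*-mono ⟨ g , s ⟩ (∃-adj₁ ⊑.refl) ⟩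
    (⟨ g , s ⟩ ^*) ((π₁ ^*) (∃ₗ χ))           ≡⟨ ^*-compose project₁ _ ⟩
    (g ^*) (∃ₗ χ)                             ∎

  ₊-transpose : ∀ {X Y} (f : X ⇒ Y) {φ χ} → φ ⊑ (f ^*) χ → (f ₊) φ ⊑ χ
  ₊-transpose f {φ} {χ} φ⊑f^*χ = ∃-adj₂ (begin
    (π₂ ^*) φ ∧ EqP (f ∘ π₂) π₁                   ≤⟨ ∧-monoˡ _ (^*-mono π₂ φ⊑f^*χ) ⟩
    (π₂ ^*) ((f ^*) χ) ∧ EqP (f ∘ π₂) π₁          ≡⟨ ≡.cong (_∧ EqP (f ∘ π₂) π₁) π₂^*f^*≡⟨id,f∘π₂⟩^*π₂^* ⟩
    (⟨ id , f ∘ π₂ ⟩ ^*) ((π₂ ^*) χ) ∧ EqP (f ∘ π₂) π₁ ≤⟨ EqP-transport (f ∘ π₂) π₁ ((π₂ ^*) χ) ⟩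
    (⟨ id , π₁ ⟩ ^*) ((π₂ ^*) χ)                  ≡⟨ ^*-compose project₂ χ ⟩
    (π₁ ^*) χ                                     ∎)
    where
    π₂^*f^*≡⟨id,f∘π₂⟩^*π₂^* : (π₂ ^*) ((f ^*) χ) ≡ (⟨ id , f ∘ π₂ ⟩ ^*) ((π₂ ^*) χ)
    π₂^*f^*≡⟨id,f∘π₂⟩^*π₂^* = ≡.trans (≡.sym (^*-∘ f π₂ χ)) (≡.sym (^*-compose project₂ χ))

  ₊-counit : ∀ {X Y} (f : X ⇒ Y) (χ : Fib Y) → (f ₊) ((f ^*) χ) ⊑ χ
  ₊-counit f χ = ₊-transpose f ⊑.refl

  -- The witness for the existential in f₊ φ is the point itself: ⟨f,id⟩.
  ₊-unit : ∀ {X Y} (f : X ⇒ Y) (φ : Fib X) → φ ⊑ (f ^*) ((f ₊) φ)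
  ₊-unit f φ = begin
    φ                                             ≤⟨ ∧-glb (⊑.reflexive (≡.sym (^*-id φ))) (⊤-max φ) ⟩
    (id ^*) φ ∧ ⊤                                 ≤⟨ ∧-glb (∧-lb₁ _ _) (⊑.trans (∧-lb₂ _ _) (Eqₗ-refl ⟨ f , id ⟩ f)) ⟩
    (id ^*) φ ∧ (⟨ ⟨ ⟨ f , id ⟩ , f ⟩ , f ⟩ ^*) (Eqₗ ⊤)
      ≡⟨ ≡.sym (≡.cong₂ _∧_ (^*-compose project₂ φ) (^*-compose diagonal (Eqₗ ⊤))) ⟩
    (⟨ f , id ⟩ ^*) ((π₂ ^*) φ) ∧ (⟨ f , id ⟩ ^*) (EqP (f ∘ π₂) π₁)
      ≡⟨ ≡.sym (^*-∧ ⟨ f , id ⟩ _ _) ⟩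
    (⟨ f , id ⟩ ^*) ((π₂ ^*) φ ∧ EqP (f ∘ π₂) π₁)  ≤⟨ ∃-intro f id _ ⟩
    (f ^*) ((f ₊) φ)                              ∎
    where
    diagonal : ⟨ ⟨ id , f ∘ π₂ ⟩ , π₁ ⟩ ∘ ⟨ f , id ⟩ ≈ ⟨ ⟨ ⟨ f , id ⟩ , f ⟩ , f ⟩
    diagonal = ⟨⟩∘ ≫ ⟨⟩-cong₂ (⟨⟩∘ ≫ ⟨⟩-cong₂ identityˡ
                                        (assoc ≫ ∘-resp-≈ ≈.refl project₂ ≫ identityʳ))
                               project₁

  graph-image-on-Eq : ∀ {X Y} (ψ : Fib X) (e c : X ⇒ Y) →
    ψ ∧ EqP e c ⊑ (⟨ id , e ⟩ ^*) ((⟨ id , c ⟩ ₊) ((⟨ id , c ⟩ ^*) ((⟨ id , e ⟩ ₊) ψ)))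
  graph-image-on-Eq {X} {Y} ψ e c = begin
    ψ ∧ EqP e c                                   ≤⟨ ∧-monoˡ _ (₊-unit ⟨ id , e ⟩ ψ) ⟩
    (⟨ id , e ⟩ ^*) I ∧ EqP e c                   ≤⟨ ∧-glb (EqP-transport e c I) (∧-lb₂ _ _) ⟩
    (⟨ id , c ⟩ ^*) I ∧ EqP e c                   ≤⟨ ∧-glb (∧-lb₁ _ _) (⊑.trans (∧-lb₂ _ _) (EqP-sym e c)) ⟩
    (⟨ id , c ⟩ ^*) I ∧ EqP c e                   ≤⟨ ∧-monoˡ _ (₊-unit ⟨ id , c ⟩ _) ⟩
    (⟨ id , c ⟩ ^*) K ∧ EqP c e                   ≤⟨ EqP-transport c e K ⟩
    (⟨ id , e ⟩ ^*) K                             ∎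
    where
    I K : Fib (X ×ₒ Y)
    I = (⟨ id , e ⟩ ₊) ψ
    K = (⟨ id , c ⟩ ₊) ((⟨ id , c ⟩ ^*) I)

  image-split : ∀ {X B : Obj} (t f : X ⇒ B) (ψ : Fib X) (e : X ⇒ B) →
    ψ ⊑ EqP e t ∨ EqP e f →
    (⟨ id , e ⟩ ₊) ψ
      ≡ (⟨ id , t ⟩ ₊) ((⟨ id , t ⟩ ^*) ((⟨ id , e ⟩ ₊) ψ))
        ∨ (⟨ id , f ⟩ ₊) ((⟨ id , f ⟩ ^*) ((⟨ id , e ⟩ ₊) ψ))
  image-split {X} {B} t f ψ e ψ⊑Eq∨Eq =
    ⊑.antisym (₊-transpose ⟨ id , e ⟩ ψ⊑⟨id,e⟩^*split)
              (∨-lub (₊-counit ⟨ id , t ⟩ _) (₊-counit ⟨ id , f ⟩ _))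
    where
    part : X ⇒ B → Fib (X ×ₒ B)
    part c = (⟨ id , c ⟩ ₊) ((⟨ id , c ⟩ ^*) ((⟨ id , e ⟩ ₊) ψ))
    ψ⊑⟨id,e⟩^*split : ψ ⊑ (⟨ id , e ⟩ ^*) (part t ∨ part f)
    ψ⊑⟨id,e⟩^*split = begin
      ψ                                           ≤⟨ ∧-glb ⊑.refl ψ⊑Eq∨Eq ⟩
      ψ ∧ (EqP e t ∨ EqP e f)                     ≤⟨ distrib _ _ _ ⟩
      (ψ ∧ EqP e t) ∨ (ψ ∧ EqP e f)               ≤⟨ ∨-mono (graph-image-on-Eq ψ e t) (graph-image-on-Eq ψ e f) ⟩
      (⟨ id , e ⟩ ^*) (part t) ∨ (⟨ id , e ⟩ ^*) (part f) ≡⟨ ≡.sym (^*-∨ ⟨ id , e ⟩ _ _) ⟩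
      (⟨ id , e ⟩ ^*) (part t ∨ part f)           ∎

mainTheorem5 : ∀ {o ℓ e p q : Level}
    (𝕍 : Category o ℓ e) (C : Cartesian 𝕍)
    (D : DistributiveCountableCoproducts 𝕍 C)
    (ℙ : AssertionFibration 𝕍 C p q) →
    let open Category 𝕍
        open Cartesian C
        open AssertionFibration ℙ
    in (B : Obj) (tt ff : 𝟙 ⇒ B) →
       IsCoproduct 𝕍 (λ (b : Bool) → 𝟙) B (λ b → if b then tt else ff) →
       (X : Obj) (ψ : Fib X) (e : X ⇒ B) →
       ψ ⊑ EqP e (tt ∘ !) ∨ EqP e (ff ∘ !) →
       (⟨ id , e ⟩ ₊) ψ
         ≡ (⟨ id , tt ∘ ! ⟩ ₊) ((⟨ id , tt ∘ ! ⟩ ^*) ((⟨ id , e ⟩ ₊) ψ))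
           ∨ (⟨ id , ff ∘ ! ⟩ ₊) ((⟨ id , ff ∘ ! ⟩ ^*) ((⟨ id , e ⟩ ₊) ψ))
mainTheorem5 𝕍 C _ ℙ B tt ff _ X ψ e =
  AssertionLogic.image-split ℙ (tt ∘ !) (ff ∘ !) ψ e
  where open Category 𝕍
        open Cartesian C
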